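{- Let $r\ge0$ and $m,n>1$ be integers. Then \[\sum_{1\le k_m<\cdots<k_1\le n}\frac{1}{(k_1+r)\cdots(k_m+r)}=\sum_{\substack{i+j=m\\ i,j\ge0}}(-1)^i\,\zeta_r^\star(\{1\}_i)\,\zeta_{n+r}(\{1\}_j).\]
   Context: $\{1\}_q$ denotes $1$ repeated $q$ times. For a positive integer $N$, $\zeta_N(\{1\}_j)=\sum_{N\ge n_1>\cdots>n_j\ge1}\frac{1}{n_1\cdots n_j}$ and $\zeta_N^\star(\{1\}_i)=\sum_{N\ge n_1\ge\cdots\ge n_i\ge1}\frac{1}{n_1\cdots n_i}$, with $\zeta_N(\emptyset)=\zeta_N^\star(\emptyset)=1$ and $\zeta_N(\{1\}_j)=0$ if $N<j$. For $N=0$: $\zeta_0^\star(\emptyset)=\zeta_0(\emptyset)=1$ and $\zeta_0^\star(\{1\}_i)=\zeta_0(\{1\}_j)=0$ for $i,j\ge1$. -}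

module Defs where

open import Data.Nat using (ℕ; zero; suc; _∸_) renaming (_+_ to _+ℕ_)
open import Data.Rational using (ℚ; 0ℚ; 1ℚ; _+_; _*_; -_; 1/_)
open import Data.Rational.Literals using ()
open import Data.Integer using (+_)
open import Data.Rational using (_/_)

-- Σ_{N ≥ k₁ > k₂ > ⋯ > k_j ≥ 1} f(k₁)⋯f(k_j)   (strict chains; empty chain gives 1)
strictSum : (ℕ → ℚ) → ℕ → ℕ → ℚ
strictSum f zero    zero    = 1ℚ
strictSum f zero    (suc j) = 0ℚ
strictSum f (suc N) zero    = 1ℚ
strictSum f (suc N) (suc j) = strictSum f N (suc j) + f (suc N) * strictSum f N j

-- Σ_{N ≥ k₁ ≥ k₂ ≥ ⋯ ≥ k_i ≥ 1} f(k₁)⋯f(k_i)   (non-strict chains)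
weakSum : (ℕ → ℚ) → ℕ → ℕ → ℚ
weakSum f N       zero    = 1ℚ
weakSum f zero    (suc i) = 0ℚ
weakSum f (suc N) (suc i) = weakSum f N (suc i) + f (suc N) * weakSum f (suc N) i

-- 1 / (k + r) as a rational, for k ≥ 1 (value at k + r = 0 is irrelevant; never used)
inv : ℕ → ℚ
inv zero    = 0ℚ
inv (suc k) = (+ 1) / suc k

zeta : ℕ → ℕ → ℚ
zeta N j = strictSum inv N j

zetaStar : ℕ → ℕ → ℚ
zetaStar N i = weakSum inv N i

sign : ℕ → ℚ
sign zero    = 1ℚ
sign (suc i) = - sign i

sumTo : ℕ → (ℕ → ℚ) → ℚ
sumTo zero    g = g zero
sumTo (suc m) g = sumTo m g + g (suc m)

rhsSum : ℕ → ℕ → ℕ → ℚ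
rhsSum r n m = sumTo m (λ i → sign i * zetaStar r i * zeta (n +ℕ r) (m ∸ i))

lhsSum : ℕ → ℕ → ℕ → ℚ
lhsSum r n m = strictSum (λ k → inv (k +ℕ r)) n m

module Submission where

-- Generating-function proof.  Read a sequence a : ℕ → ℚ as the formal power
-- series Σ a(j) xʲ.  For weights f, the strict sums e_N = strictSum f N are the
-- coefficients of ∏_{k ≤ N} (1 + f(k) x), and the alternating weak sums
-- h_N(i) = (-1)ⁱ weakSum f N i are the coefficients of ∏_{k ≤ N} (1 + f(k) x)⁻¹.
--
-- We work with the Cauchy product _⊛_ and the operation "multiply by
-- (1 + c x)", called mulLin c, and show that the latter commutes with ⊛ in
-- either argument.  Both families satisfy a one-step recursion in N via
-- mulLin, which gives by induction on N that h_N ⊛ e_N is the unit sequence.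
-- Then, by induction on n, the strict sums with shifted weights k ↦ f(k + r)
-- equal h_r ⊛ e_{n+r}: both sides start at the unit sequence and are
-- multiplied by the same factor (1 + f(n + r + 1) x) at each step.
-- Taking f(k) = 1/k and expanding ⊛ as a finite sum gives Theorem 2.6.

open import Defs
open import Data.Nat using (ℕ; _<_; zero; suc; _∸_) renaming (_+_ to _+ℕ_)
open import Data.Rational using (ℚ; 0ℚ; 1ℚ; _+_; _*_; -_; _≟_)
open import Data.Rational.Properties
  using (+-*-commutativeRing; +-assoc; *-identityʳ; *-zeroʳ; +-identityˡ)
open import Data.Maybe using (Maybe; just; nothing)
open import Level using (0ℓ)
open import Relation.Nullary using (yes; no)
open import Relation.Binary.PropositionalEquality
  using (_≡_; _≗_; refl; sym; cong; cong₂; module ≡-Reasoning)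
open import Tactic.RingSolver.Core.AlmostCommutativeRing
  using (AlmostCommutativeRing; fromCommutativeRing)
open import Tactic.RingSolver using (solve-∀)

open ≡-Reasoning

ringℚ : AlmostCommutativeRing 0ℓ 0ℓ
ringℚ = fromCommutativeRing +-*-commutativeRing isZero
  where
  isZero : (x : ℚ) → Maybe (0ℚ ≡ x)
  isZero x with 0ℚ ≟ x
  ... | yes 0≡x = just 0≡x
  ... | no _    = nothing

unitSeq : ℕ → ℚ
unitSeq zero    = 1ℚ
unitSeq (suc _) = 0ℚ

infixl 7 _⊛_
_⊛_ : (ℕ → ℚ) → (ℕ → ℚ) → ℕ → ℚ
(a ⊛ b) zero    = a 0 * b 0
(a ⊛ b) (suc m) = a 0 * b (suc m) + ((λ i → a (suc i)) ⊛ b) m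

mulLin : ℚ → (ℕ → ℚ) → ℕ → ℚ
mulLin c b zero    = b 0
mulLin c b (suc j) = b (suc j) + c * b j

alternate : (ℕ → ℚ) → ℕ → ℚ
alternate a i = sign i * a i

sumTo-suc : ∀ m (g : ℕ → ℚ) → sumTo (suc m) g ≡ g 0 + sumTo m (λ i → g (suc i))
sumTo-suc zero    g = refl
sumTo-suc (suc m) g = begin
  sumTo (suc m) g + g (suc (suc m))
    ≡⟨ cong (_+ g (suc (suc m))) (sumTo-suc m g) ⟩
  (g 0 + sumTo m (λ i → g (suc i))) + g (suc (suc m))
    ≡⟨ +-assoc (g 0) (sumTo m (λ i → g (suc i))) (g (suc (suc m))) ⟩
  g 0 + sumTo (suc m) (λ i → g (suc i)) ∎

⊛-as-sum : ∀ m (a b : ℕ → ℚ) → (a ⊛ b) m ≡ sumTo m (λ i → a i * b (m ∸ i))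
⊛-as-sum zero    a b = refl
⊛-as-sum (suc m) a b = begin
  a 0 * b (suc m) + ((λ i → a (suc i)) ⊛ b) m
    ≡⟨ cong (a 0 * b (suc m) +_) (⊛-as-sum m (λ i → a (suc i)) b) ⟩
  a 0 * b (suc m) + sumTo m (λ i → a (suc i) * b (suc m ∸ suc i))
    ≡⟨ sym (sumTo-suc m (λ i → a i * b (suc m ∸ i))) ⟩
  sumTo (suc m) (λ i → a i * b (suc m ∸ i)) ∎

⊛-cong : ∀ {a a′ b b′ : ℕ → ℚ} → a ≗ a′ → b ≗ b′ → a ⊛ b ≗ a′ ⊛ b′
⊛-cong a≗a′ b≗b′ zero    = cong₂ _*_ (a≗a′ 0) (b≗b′ 0)
⊛-cong a≗a′ b≗b′ (suc m) =
  cong₂ _+_ (cong₂ _*_ (a≗a′ 0) (b≗b′ (suc m))) (⊛-cong (λ i → a≗a′ (suc i)) b≗b′ m)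

⊛-identityʳ : ∀ (a : ℕ → ℚ) → a ⊛ unitSeq ≗ a
⊛-identityʳ a zero    = *-identityʳ (a 0)
⊛-identityʳ a (suc m) = begin
  a 0 * 0ℚ + ((λ i → a (suc i)) ⊛ unitSeq) m
    ≡⟨ cong₂ _+_ (*-zeroʳ (a 0)) (⊛-identityʳ (λ i → a (suc i)) m) ⟩
  0ℚ + a (suc m)
    ≡⟨ +-identityˡ (a (suc m)) ⟩
  a (suc m) ∎

⊛-linearˡ : ∀ (c : ℚ) (a a′ b : ℕ → ℚ) m →
  ((λ i → a i + c * a′ i) ⊛ b) m ≡ (a ⊛ b) m + c * (a′ ⊛ b) m
⊛-linearˡ c a a′ b zero    = distrib (a 0) c (a′ 0) (b 0)
  where
  distrib : ∀ x c y z → (x + c * y) * z ≡ x * z + c * (y * z)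
  distrib = solve-∀ ringℚ
⊛-linearˡ c a a′ b (suc m) = begin
  (a 0 + c * a′ 0) * b (suc m) + ((λ i → a (suc i) + c * a′ (suc i)) ⊛ b) m
    ≡⟨ cong ((a 0 + c * a′ 0) * b (suc m) +_) (⊛-linearˡ c (λ i → a (suc i)) (λ i → a′ (suc i)) b m) ⟩
  (a 0 + c * a′ 0) * b (suc m) + (A m + c * A′ m)
    ≡⟨ regroup (a 0) c (a′ 0) (b (suc m)) (A m) (A′ m) ⟩
  (a 0 * b (suc m) + A m) + c * (a′ 0 * b (suc m) + A′ m) ∎
  where
  A A′ : ℕ → ℚ
  A  = (λ i → a (suc i)) ⊛ b
  A′ = (λ i → a′ (suc i)) ⊛ b
  regroup : ∀ x c y z p q → (x + c * y) * z + (p + c * q) ≡ (x * z + p) + c * (y * z + q)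
  regroup = solve-∀ ringℚ

⊛-mulLinˡ : ∀ (c : ℚ) (a b : ℕ → ℚ) → mulLin c a ⊛ b ≗ mulLin c (a ⊛ b)
⊛-mulLinˡ c a b zero    = refl
⊛-mulLinˡ c a b (suc m) = begin
  a 0 * b (suc m) + ((λ i → a (suc i) + c * a i) ⊛ b) m
    ≡⟨ cong (a 0 * b (suc m) +_) (⊛-linearˡ c (λ i → a (suc i)) a b m) ⟩
  a 0 * b (suc m) + (((λ i → a (suc i)) ⊛ b) m + c * (a ⊛ b) m)
    ≡⟨ sym (+-assoc (a 0 * b (suc m)) _ _) ⟩
  (a ⊛ b) (suc m) + c * (a ⊛ b) m ∎

⊛-mulLinʳ : ∀ (c : ℚ) (a b : ℕ → ℚ) → a ⊛ mulLin c b ≗ mulLin c (a ⊛ b)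
⊛-mulLinʳ c a b zero          = refl
⊛-mulLinʳ c a b (suc zero)    = regroup (a 0) (b 1) c (b 0) (a 1 * b 0)
  where
  regroup : ∀ x y c z p → x * (y + c * z) + p ≡ (x * y + p) + c * (x * z)
  regroup = solve-∀ ringℚ
⊛-mulLinʳ c a b (suc (suc m)) = begin
  a 0 * (b (2 +ℕ m) + c * b (suc m)) + ((λ i → a (suc i)) ⊛ mulLin c b) (suc m)
    ≡⟨ cong (a 0 * (b (2 +ℕ m) + c * b (suc m)) +_) (⊛-mulLinʳ c (λ i → a (suc i)) b (suc m)) ⟩
  a 0 * (b (2 +ℕ m) + c * b (suc m)) + (A (suc m) + c * A m)
    ≡⟨ regroup (a 0) (b (2 +ℕ m)) c (b (suc m)) (A (suc m)) (A m) ⟩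
  (a 0 * b (2 +ℕ m) + A (suc m)) + c * (a 0 * b (suc m) + A m) ∎
  where
  A : ℕ → ℚ
  A = (λ i → a (suc i)) ⊛ b
  regroup : ∀ x y c z p q → x * (y + c * z) + (p + c * q) ≡ (x * y + p) + c * (x * z + q)
  regroup = solve-∀ ringℚ

mulLin-cong : ∀ (c : ℚ) {b b′ : ℕ → ℚ} → b ≗ b′ → mulLin c b ≗ mulLin c b′
mulLin-cong c b≗b′ zero    = b≗b′ 0
mulLin-cong c b≗b′ (suc j) = cong₂ _+_ (b≗b′ (suc j)) (cong (c *_) (b≗b′ j))

strictSum-zero : ∀ (f : ℕ → ℚ) → strictSum f 0 ≗ unitSeq
strictSum-zero f zero    = refl
strictSum-zero f (suc j) = refl

strictSum-suc : ∀ (f : ℕ → ℚ) N → strictSum f (suc N) ≗ mulLin (f (suc N)) (strictSum f N)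
strictSum-suc f N       (suc j) = refl
strictSum-suc f zero    zero    = refl
strictSum-suc f (suc N) zero    = refl

alternate-weakSum-zero : ∀ (f : ℕ → ℚ) → alternate (weakSum f 0) ≗ unitSeq
alternate-weakSum-zero f zero    = refl
alternate-weakSum-zero f (suc i) = *-zeroʳ (- sign i)

-- h_N = (1 + f(N+1) x) h_{N+1}, i.e. h_{N+1} = h_N / (1 + f(N+1) x); this is
-- the recursion of weakSum in N, rewritten with signs.
alternate-weakSum-suc : ∀ (f : ℕ → ℚ) N →
  alternate (weakSum f N) ≗ mulLin (f (suc N)) (alternate (weakSum f (suc N)))
alternate-weakSum-suc f N zero    = refl
alternate-weakSum-suc f N (suc i) =
  regroup (sign i) (weakSum f N (suc i)) (f (suc N)) (weakSum f (suc N) i)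
  where
  regroup : ∀ s w c w′ → - s * w ≡ - s * (w + c * w′) + c * (s * w′)
  regroup = solve-∀ ringℚ

weak-strict-inverse : ∀ (f : ℕ → ℚ) N →
  alternate (weakSum f N) ⊛ strictSum f N ≗ unitSeq
weak-strict-inverse f zero m = begin
  (alternate (weakSum f 0) ⊛ strictSum f 0) m
    ≡⟨ ⊛-cong (λ _ → refl) (strictSum-zero f) m ⟩
  (alternate (weakSum f 0) ⊛ unitSeq) m
    ≡⟨ ⊛-identityʳ (alternate (weakSum f 0)) m ⟩
  alternate (weakSum f 0) m
    ≡⟨ alternate-weakSum-zero f m ⟩
  unitSeq m ∎
weak-strict-inverse f (suc N) m = begin
  (h (suc N) ⊛ strictSum f (suc N)) m
    ≡⟨ ⊛-cong (λ _ → refl) (strictSum-suc f N) m ⟩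
  (h (suc N) ⊛ mulLin c (strictSum f N)) m
    ≡⟨ ⊛-mulLinʳ c (h (suc N)) (strictSum f N) m ⟩
  mulLin c (h (suc N) ⊛ strictSum f N) m
    ≡⟨ sym (⊛-mulLinˡ c (h (suc N)) (strictSum f N) m) ⟩
  (mulLin c (h (suc N)) ⊛ strictSum f N) m
    ≡⟨ ⊛-cong (λ i → sym (alternate-weakSum-suc f N i)) (λ _ → refl) m ⟩
  (h N ⊛ strictSum f N) m
    ≡⟨ weak-strict-inverse f N m ⟩
  unitSeq m ∎
  where
  c : ℚ
  c = f (suc N)
  h : ℕ → ℕ → ℚ
  h K = alternate (weakSum f K)

-- Strict sums with shifted weights k ↦ f(k + r) over k ≤ n equal h_r ⊛ e_{n+r}:
-- in power series, ∏_{r < k ≤ n+r} (1 + f(k) x) = ∏_{k ≤ r} (1 + f(k) x)⁻¹ · ∏_{k ≤ n+r} (1 + f(k) x).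
shifted-strictSum : ∀ (f : ℕ → ℚ) r n →
  strictSum (λ k → f (k +ℕ r)) n ≗ alternate (weakSum f r) ⊛ strictSum f (n +ℕ r)
shifted-strictSum f r zero m = begin
  strictSum (λ k → f (k +ℕ r)) 0 m
    ≡⟨ strictSum-zero (λ k → f (k +ℕ r)) m ⟩
  unitSeq m
    ≡⟨ sym (weak-strict-inverse f r m) ⟩
  (alternate (weakSum f r) ⊛ strictSum f r) m ∎
shifted-strictSum f r (suc n) m = begin
  strictSum (λ k → f (k +ℕ r)) (suc n) m
    ≡⟨ strictSum-suc (λ k → f (k +ℕ r)) n m ⟩
  mulLin c (strictSum (λ k → f (k +ℕ r)) n) m
    ≡⟨ mulLin-cong c (shifted-strictSum f r n) m ⟩
  mulLin c (h ⊛ strictSum f (n +ℕ r)) m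
    ≡⟨ sym (⊛-mulLinʳ c h (strictSum f (n +ℕ r)) m) ⟩
  (h ⊛ mulLin c (strictSum f (n +ℕ r))) m
    ≡⟨ ⊛-cong (λ _ → refl) (λ j → sym (strictSum-suc f (n +ℕ r) j)) m ⟩
  (h ⊛ strictSum f (suc n +ℕ r)) m ∎
  where
  c : ℚ
  c = f (suc (n +ℕ r))
  h : ℕ → ℚ
  h = alternate (weakSum f r)

theorem2p6 : (r m n : ℕ) → 1 < m → 1 < n →
    lhsSum r n m ≡ rhsSum r n m
theorem2p6 r m n _ _ = begin
  lhsSum r n m
    ≡⟨ shifted-strictSum inv r n m ⟩
  (alternate (zetaStar r) ⊛ zeta (n +ℕ r)) m
    ≡⟨ ⊛-as-sum m (alternate (zetaStar r)) (zeta (n +ℕ r)) ⟩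
  rhsSum r n m ∎
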